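{- Let $d$ be a square-free integer and let $n \in \mathbb{Z}[\sqrt{d}]$ be nonzero. Suppose $a, b, r, \alpha \in \mathbb{Z}[\sqrt{d}]$ satisfy $ab + n = r^2$ and $3n = \alpha_1 \alpha_2$, where $\alpha_1 = a + 2r + \alpha$ and $\alpha_2 = a + 2r - \alpha$, and suppose that the four elements $a$, $b$, $a+b+2r$, $a+4b+4r$ are nonzero and pairwise distinct. Then $\{a, b, a+b+2r, a+4b+4r\}$ is a quadruple in $\mathbb{Z}[\sqrt{d}]$ with the property $D(n)$.
   Context: For a commutative ring $\mathcal{R}$ with unity and a nonzero $n \in \mathcal{R}$, a set $\{a_1, \dots, a_m\} \subset \mathcal{R} \setminus \{0\}$ of $m$ distinct elements has the property $D(n)$ if $a_i a_j + n$ is a perfect square in $\mathcal{R}$ for all $1 \le i < j \le m$; for $m=4$ it is called a quadruple with the property $D(n)$. -}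

module Defs where

open import Data.Nat as ℕ using (ℕ)
open import Data.Nat.Divisibility as ℕD using ()
open import Data.Integer as ℤ using (ℤ; ∣_∣)
open import Data.Fin using (Fin)
open import Data.Vec using (Vec; lookup)
open import Data.Product using (∃; _×_; _,_)
open import Relation.Binary.PropositionalEquality using (_≡_; _≢_)
open import Relation.Nullary using (¬_)

-- A square-free integer: no square of a natural number k > 1 divides d.
-- (d = 0 is thereby excluded, d = ±1 allowed.)
SquareFree : ℤ → Set
SquareFree d = ∀ (k : ℕ) → (k ℕ.* k) ℕD.∣ ∣ d ∣ → k ≡ 1

infix 5 _+√_

record ℤ√ : Set where
  constructor _+√_
  field
    re : ℤ
    im : ℤ
open ℤ√ public

module ℤ[√_] (d : ℤ) where
  infixl 6 _+_ _-_
  infixl 7 _*_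
  infix 8 -_

  _+_ : ℤ√ → ℤ√ → ℤ√
  (a +√ b) + (c +√ e) = (a ℤ.+ c) +√ (b ℤ.+ e)

  -_ : ℤ√ → ℤ√
  - (a +√ b) = (ℤ.- a) +√ (ℤ.- b)

  _-_ : ℤ√ → ℤ√ → ℤ√
  x - y = x + (- y)

  -- (a + b√d)(c + e√d) = (ac + d b e) + (a e + b c)√d
  _*_ : ℤ√ → ℤ√ → ℤ√
  (a +√ b) * (c +√ e) = (a ℤ.* c ℤ.+ d ℤ.* (b ℤ.* e)) +√ (a ℤ.* e ℤ.+ b ℤ.* c)

  0# 1# : ℤ√
  0# = ℤ.0ℤ +√ ℤ.0ℤ
  1# = ℤ.1ℤ +√ ℤ.0ℤ

  ι : ℤ → ℤ√
  ι k = k +√ ℤ.0ℤ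

  IsSquare : ℤ√ → Set
  IsSquare x = ∃ λ s → s * s ≡ x

  -- {a₁,…,aₘ}, m distinct nonzero elements, has property D(n):
  -- aᵢ aⱼ + n is a perfect square for all i < j (equivalently i ≢ j,
  -- as the ring is commutative).
  HasPropertyD : ∀ {m} → ℤ√ → Vec ℤ√ m → Set
  HasPropertyD n v =
    (∀ i → lookup v i ≢ 0#) ×
    (∀ i j → i ≢ j → lookup v i ≢ lookup v j) ×
    (∀ i j → i ≢ j → IsSquare (lookup v i * lookup v j + n))

  DQuadruple : ℤ√ → Vec ℤ√ 4 → Set
  DQuadruple = HasPropertyD

-- Write c = a + b + 2r and e = a + 4b + 4r.  Substituting n = r² − ab turns
-- ab + n, ac + n, bc + n, be + n and ce + n into the squares of r, a + r,
-- b + r, 2b + r and a + 2b + 3r, by polynomial identities in a, b, r.  The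
-- remaining product gives ae + n = (a + 2r)² − 3n, which is α² by the
-- factorisation 3n = (a + 2r + α)(a + 2r − α).
module Submission where

open import Defs
open import Data.Integer using (ℤ; +_)
open import Data.Vec using (Vec; []; _∷_; lookup)
open import Relation.Binary.PropositionalEquality
  using (_≡_; _≢_; refl; sym; trans; cong; cong₂; isEquivalence; ≢-sym; module ≡-Reasoning)

import Data.Integer.Properties as ℤ
open import Data.Integer.Tactic.RingSolver using (solve-∀)
open import Algebra.Bundles using (CommutativeRing)
open import Algebra.Structures using (IsCommutativeRing)
import Algebra.Solver.Ring
import Algebra.Solver.Ring.AlmostCommutativeRing as ACR
open import Data.Fin using (zero; suc)
open import Data.Maybe using (Maybe; just; nothing)
open import Data.Product using (_,_)
open import Data.Vec.Relation.Unary.All using (All; []; _∷_)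
import Data.Vec.Relation.Unary.All.Properties as All
open import Data.Vec.Relation.Unary.AllPairs using (AllPairs; []; _∷_)
open import Function using (_∘_)
open import Level using (0ℓ)
open import Relation.Binary.Definitions using (Symmetric)
open import Relation.Binary.Core using (Rel)
open import Relation.Nullary using (yes; no; contradiction)

module _ {a ℓ} {A : Set a} {R : Rel A ℓ} (R-sym : Symmetric R) where

  allPairs-lookup : ∀ {m} {xs : Vec A m} → AllPairs R xs →
                    ∀ i j → i ≢ j → R (lookup xs i) (lookup xs j)
  allPairs-lookup (px ∷ pxs) zero    zero    i≢j = contradiction refl i≢j
  allPairs-lookup (px ∷ pxs) zero    (suc j) _   = All.lookup⁺ px j
  allPairs-lookup (px ∷ pxs) (suc i) zero    _   = R-sym (All.lookup⁺ px i)
  allPairs-lookup (px ∷ pxs) (suc i) (suc j) i≢j = allPairs-lookup pxs i j (i≢j ∘ cong suc)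

private
  module Coordinates where
    open import Data.Integer using (_+_; _*_; 0ℤ; 1ℤ)

    *-assoc-re : ∀ d a b c e f g →
      (a * c + d * (b * e)) * f + d * ((a * e + b * c) * g) ≡
      a * (c * f + d * (e * g)) + d * (b * (c * g + e * f))
    *-assoc-re = solve-∀

    *-assoc-im : ∀ d a b c e f g →
      (a * c + d * (b * e)) * g + (a * e + b * c) * f ≡
      a * (c * g + e * f) + b * (c * f + d * (e * g))
    *-assoc-im = solve-∀

    *-comm-re : ∀ d a b c e → a * c + d * (b * e) ≡ c * a + d * (e * b)
    *-comm-re = solve-∀

    *-comm-im : ∀ a b c e → a * e + b * c ≡ c * b + e * a
    *-comm-im = solve-∀

    *-identityˡ-re : ∀ d a b → 1ℤ * a + d * (0ℤ * b) ≡ a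
    *-identityˡ-re = solve-∀

    *-identityˡ-im : ∀ a b → 1ℤ * b + 0ℤ * a ≡ b
    *-identityˡ-im = solve-∀

    *-distribˡ-+-re : ∀ d a b c e f g →
      a * (c + f) + d * (b * (e + g)) ≡ (a * c + d * (b * e)) + (a * f + d * (b * g))
    *-distribˡ-+-re = solve-∀

    *-distribˡ-+-im : ∀ a b c e f g →
      a * (e + g) + b * (c + f) ≡ (a * e + b * c) + (a * g + b * f)
    *-distribˡ-+-im = solve-∀

    ι-*-homo-re : ∀ d x y → x * y ≡ x * y + d * (0ℤ * 0ℤ)
    ι-*-homo-re = solve-∀

    ι-*-homo-im : ∀ x y → 0ℤ ≡ x * 0ℤ + 0ℤ * y
    ι-*-homo-im = solve-∀

module ℤ[√_]-Properties (d : ℤ) where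
  open ℤ[√_] d
  open Coordinates
  open import Algebra.Definitions (_≡_ {A = ℤ√})
  open import Algebra.Consequences.Propositional {A = ℤ√}
    using (comm∧idˡ⇒id; comm∧distrˡ⇒distr)

  +-assoc : Associative _+_
  +-assoc (a +√ b) (c +√ e) (f +√ g) = cong₂ _+√_ (ℤ.+-assoc a c f) (ℤ.+-assoc b e g)

  +-comm : Commutative _+_
  +-comm (a +√ b) (c +√ e) = cong₂ _+√_ (ℤ.+-comm a c) (ℤ.+-comm b e)

  +-identity : Identity 0# _+_
  +-identity = (λ { (a +√ b) → cong₂ _+√_ (ℤ.+-identityˡ a) (ℤ.+-identityˡ b) })
             , (λ { (a +√ b) → cong₂ _+√_ (ℤ.+-identityʳ a) (ℤ.+-identityʳ b) })

  +-inverse : Inverse 0# -_ _+_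
  +-inverse = (λ { (a +√ b) → cong₂ _+√_ (ℤ.+-inverseˡ a) (ℤ.+-inverseˡ b) })
            , (λ { (a +√ b) → cong₂ _+√_ (ℤ.+-inverseʳ a) (ℤ.+-inverseʳ b) })

  *-assoc : Associative _*_
  *-assoc (a +√ b) (c +√ e) (f +√ g) =
    cong₂ _+√_ (*-assoc-re d a b c e f g) (*-assoc-im d a b c e f g)

  *-comm : Commutative _*_
  *-comm (a +√ b) (c +√ e) = cong₂ _+√_ (*-comm-re d a b c e) (*-comm-im a b c e)

  *-identityˡ : LeftIdentity 1# _*_
  *-identityˡ (a +√ b) = cong₂ _+√_ (*-identityˡ-re d a b) (*-identityˡ-im a b)

  *-distribˡ-+ : _*_ DistributesOverˡ _+_
  *-distribˡ-+ (a +√ b) (c +√ e) (f +√ g) =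
    cong₂ _+√_ (*-distribˡ-+-re d a b c e f g) (*-distribˡ-+-im a b c e f g)

  +-*-isCommutativeRing : IsCommutativeRing _≡_ _+_ _*_ -_ 0# 1#
  +-*-isCommutativeRing = record
    { isRing = record
      { +-isAbelianGroup = record
        { isGroup = record
          { isMonoid = record
            { isSemigroup = record
              { isMagma = record { isEquivalence = isEquivalence ; ∙-cong = cong₂ _+_ }
              ; assoc = +-assoc
              }
            ; identity = +-identity
            }
          ; inverse = +-inverse
          ; ⁻¹-cong = cong (-_)
          }
        ; comm = +-comm
        }
      ; *-cong = cong₂ _*_
      ; *-assoc = *-assoc
      ; *-identity = comm∧idˡ⇒id *-comm *-identityˡ
      ; distrib = comm∧distrˡ⇒distr (cong₂ _+_) *-comm *-distribˡ-+
      }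
    ; *-comm = *-comm
    }

  +-*-commutativeRing : CommutativeRing 0ℓ 0ℓ
  +-*-commutativeRing = record { isCommutativeRing = +-*-isCommutativeRing }

  ι-homomorphism : ACR._-Raw-AlmostCommutative⟶_
    (CommutativeRing.rawRing ℤ.+-*-commutativeRing)
    (ACR.fromCommutativeRing +-*-commutativeRing)
  ι-homomorphism = record
    { ⟦_⟧    = ι
    ; +-homo = λ _ _ → refl
    ; *-homo = λ x y → cong₂ _+√_ (ι-*-homo-re d x y) (ι-*-homo-im x y)
    ; -‿homo = λ _ → refl
    ; 0-homo = refl
    ; 1-homo = refl
    }

  ι-≟ : (x y : ℤ) → Maybe (ι x ≡ ι y)
  ι-≟ x y with x ℤ.≟ y
  ... | yes x≡y = just (cong ι x≡y)
  ... | no _    = nothing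

  open Algebra.Solver.Ring
    (CommutativeRing.rawRing ℤ.+-*-commutativeRing)
    (ACR.fromCommutativeRing +-*-commutativeRing)
    ι-homomorphism ι-≟
    public

module PropertyD (d : ℤ) where
  open ℤ[√_] d
  open ℤ[√_]-Properties d
  open ≡-Reasoning

  HasPropertyD-intro : ∀ {m} {n : ℤ√} {xs : Vec ℤ√ m} →
    All (_≢ 0#) xs → AllPairs _≢_ xs → AllPairs (λ x y → IsSquare (x * y + n)) xs →
    HasPropertyD n xs
  HasPropertyD-intro {n = n} nonzero distinct squares =
    All.lookup⁺ nonzero ,
    allPairs-lookup ≢-sym distinct ,
    -- η-expanded: x and y cannot be recovered by unification from x * y + n.
    allPairs-lookup (λ {x} {y} → square-sym {x} {y}) squares
    where
    square-sym : Symmetric (λ x y → IsSquare (x * y + n))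
    square-sym {x} {y} (s , s²≡xy+n) = s , trans s²≡xy+n (cong (λ m → m + n) (*-comm x y))

  module Identities (n a b r : ℤ√) (ab+n≡r² : a * b + n ≡ r * r) where

    c e : ℤ√
    c = a + b + ι (+ 2) * r
    e = a + ι (+ 4) * b + ι (+ 4) * r

    n≡r²-ab : n ≡ r * r - a * b
    n≡r²-ab = begin
      n                 ≡⟨ solve 3 (λ a b n → n := a :* b :+ n :- a :* b) refl a b n ⟩
      a * b + n - a * b ≡⟨ cong (_- a * b) ab+n≡r² ⟩
      r * r - a * b     ∎

    eliminate-n : ∀ x s → x + (r * r - a * b) ≡ s * s → x + n ≡ s * s
    eliminate-n x s eq = trans (cong (λ m → x + m) n≡r²-ab) eq

    a*c+n≡[a+r]² : a * c + n ≡ (a + r) * (a + r)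
    a*c+n≡[a+r]² = eliminate-n (a * c) (a + r)
      (solve 3 (λ a b r → a :* (a :+ b :+ con (+ 2) :* r) :+ (r :* r :- a :* b)
                          := (a :+ r) :* (a :+ r)) refl a b r)

    b*c+n≡[b+r]² : b * c + n ≡ (b + r) * (b + r)
    b*c+n≡[b+r]² = eliminate-n (b * c) (b + r)
      (solve 3 (λ a b r → b :* (a :+ b :+ con (+ 2) :* r) :+ (r :* r :- a :* b)
                          := (b :+ r) :* (b :+ r)) refl a b r)

    b*e+n≡[2b+r]² : b * e + n ≡ (ι (+ 2) * b + r) * (ι (+ 2) * b + r)
    b*e+n≡[2b+r]² = eliminate-n (b * e) (ι (+ 2) * b + r)
      (solve 3 (λ a b r → b :* (a :+ con (+ 4) :* b :+ con (+ 4) :* r) :+ (r :* r :- a :* b)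
                          := (con (+ 2) :* b :+ r) :* (con (+ 2) :* b :+ r)) refl a b r)

    c*e+n≡[a+2b+3r]² :
      c * e + n ≡ (a + ι (+ 2) * b + ι (+ 3) * r) * (a + ι (+ 2) * b + ι (+ 3) * r)
    c*e+n≡[a+2b+3r]² = eliminate-n (c * e) (a + ι (+ 2) * b + ι (+ 3) * r)
      (solve 3 (λ a b r → (a :+ b :+ con (+ 2) :* r) :* (a :+ con (+ 4) :* b :+ con (+ 4) :* r)
                            :+ (r :* r :- a :* b)
                          := (a :+ con (+ 2) :* b :+ con (+ 3) :* r)
                               :* (a :+ con (+ 2) :* b :+ con (+ 3) :* r))
               refl a b r)

    a*e+n≡α² : ∀ {α} → ι (+ 3) * n ≡ (a + ι (+ 2) * r + α) * (a + ι (+ 2) * r - α) →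
               a * e + n ≡ α * α
    a*e+n≡α² {α} 3n≡[s+α][s-α] = begin
      a * e + n
        ≡⟨ cong (λ m → a * e + m) n≡r²-ab ⟩
      a * e + (r * r - a * b)
        ≡⟨ solve 3 (λ a b r → a :* (a :+ con (+ 4) :* b :+ con (+ 4) :* r) :+ (r :* r :- a :* b)
                              := (a :+ con (+ 2) :* r) :* (a :+ con (+ 2) :* r)
                                   :- con (+ 3) :* (r :* r :- a :* b))
                 refl a b r ⟩
      s * s - ι (+ 3) * (r * r - a * b)
        ≡⟨ cong (λ m → s * s - ι (+ 3) * m) (sym n≡r²-ab) ⟩
      s * s - ι (+ 3) * n
        ≡⟨ cong (λ m → s * s - m) 3n≡[s+α][s-α] ⟩
      s * s - (s + α) * (s - α)
        ≡⟨ solve 2 (λ s α → s :* s :- (s :+ α) :* (s :- α) := α :* α) refl s α ⟩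
      α * α ∎
      where
      s : ℤ√
      s = a + ι (+ 2) * r

lemma2p5 : (d : ℤ) → SquareFree d →
    let open ℤ[√_] d in
    (n a b r α : ℤ√) → n ≢ 0# →
    a * b + n ≡ r * r →
    ι (+ 3) * n ≡ (a + ι (+ 2) * r + α) * (a + ι (+ 2) * r - α) →
    a ≢ 0# → b ≢ 0# → a + b + ι (+ 2) * r ≢ 0# →
    a + ι (+ 4) * b + ι (+ 4) * r ≢ 0# →
    a ≢ b → a ≢ a + b + ι (+ 2) * r →
    a ≢ a + ι (+ 4) * b + ι (+ 4) * r →
    b ≢ a + b + ι (+ 2) * r →
    b ≢ a + ι (+ 4) * b + ι (+ 4) * r →
    a + b + ι (+ 2) * r ≢ a + ι (+ 4) * b + ι (+ 4) * r →
    DQuadruple n (a ∷ b ∷ (a + b + ι (+ 2) * r) ∷ (a + ι (+ 4) * b + ι (+ 4) * r) ∷ [])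
lemma2p5 d _ n a b r α _ ab+n≡r² 3n≡[s+α][s-α]
         a≢0 b≢0 c≢0 e≢0 a≢b a≢c a≢e b≢c b≢e c≢e =
  HasPropertyD-intro
    (a≢0 ∷ b≢0 ∷ c≢0 ∷ e≢0 ∷ [])
    ((a≢b ∷ a≢c ∷ a≢e ∷ []) ∷ (b≢c ∷ b≢e ∷ []) ∷ (c≢e ∷ []) ∷ [] ∷ [])
    ( ( (r , sym ab+n≡r²)
      ∷ (a + r , sym a*c+n≡[a+r]²)
      ∷ (α , sym (a*e+n≡α² 3n≡[s+α][s-α]))
      ∷ [])
    ∷ ( (b + r , sym b*c+n≡[b+r]²)
      ∷ (ι (+ 2) * b + r , sym b*e+n≡[2b+r]²)
      ∷ [])
    ∷ ((a + ι (+ 2) * b + ι (+ 3) * r , sym c*e+n≡[a+2b+3r]²) ∷ [])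
    ∷ [] ∷ [])
  where
  open ℤ[√_] d
  open PropertyD d
  open Identities n a b r ab+n≡r²
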